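{- Let $G$ be a simple graph on $n$ vertices, let $\Sigma\subseteq E(G)$ be a signature, and let $\Sigma'$ be a minimal signature equivalent to $\Sigma$. Then for every vertex $v$ of $G$, the number of edges of $\Sigma'$ incident with $v$ is at most $\lfloor \frac{n-1}{2}\rfloor$.
   Context: A signature of a graph $G$ is a set $\Sigma\subseteq E(G)$ of edges (the negative edges). Resigning (switching) at a vertex $v$ replaces $\Sigma$ by its symmetric difference with the set of edges incident with $v$. Two signatures are (switching) equivalent if one is obtained from the other by a sequence of resignings. A minimal signature equivalent to $\Sigma$ is a signature equivalent to $\Sigma$ with the minimum number of edges among all signatures equivalent to $\Sigma$. -}

module Defs where

open import Data.Nat using (ℕ; _+_; _<ᵇ_; _≤_)
open import Data.Bool using (Bool; true; false; _∧_; _xor_; if_then_else_)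
open import Data.Fin using (Fin; toℕ; _≟_)
open import Data.List using (List; map; allFin)
open import Data.Nat.ListAction using (sum)
open import Data.Product using (∃; _×_)
open import Relation.Nullary.Decidable using (⌊_⌋)
open import Relation.Binary.PropositionalEquality using (_≡_)
open import Relation.Binary.Construct.Closure.ReflexiveTransitive using (Star)

record SimpleGraph (n : ℕ) : Set where
  field
    adj     : Fin n → Fin n → Bool
    adj-sym : ∀ i j → adj i j ≡ adj j i
    irrefl  : ∀ i → adj i i ≡ false
open SimpleGraph public

-- A signature is given by its (symmetric) indicator on vertex pairs;
-- sig i j = true means ij is a negative edge.
Sig : ℕ → Set
Sig n = Fin n → Fin n → Bool

record IsSignature {n : ℕ} (G : SimpleGraph n) (σ : Sig n) : Set where
  field
    sig-sym : ∀ i j → σ i j ≡ σ j i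
    sig-sub : ∀ i j → σ i j ≡ true → adj G i j ≡ true

resign : ∀ {n} → SimpleGraph n → Fin n → Sig n → Sig n
resign G v σ i j = σ i j xor (adj G i j ∧ (⌊ i ≟ v ⌋ xor ⌊ j ≟ v ⌋))

ResignStep : ∀ {n} → SimpleGraph n → Sig n → Sig n → Set
ResignStep G σ τ = ∃ λ v → ∀ i j → τ i j ≡ resign G v σ i j

Equivalent : ∀ {n} → SimpleGraph n → Sig n → Sig n → Set
Equivalent G = Star (ResignStep G)

count : ∀ {n} → (Fin n → Bool) → ℕ
count {n} f = sum (map (λ x → if f x then 1 else 0) (allFin n))

numEdges : ∀ {n} → Sig n → ℕ
numEdges {n} σ = sum (map (λ i → count (λ j → (toℕ i <ᵇ toℕ j) ∧ σ i j)) (allFin n))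

degSig : ∀ {n} → Sig n → Fin n → ℕ
degSig σ v = count (λ u → σ v u)

IsMinimalEquivalent : ∀ {n} → SimpleGraph n → Sig n → Sig n → Set
IsMinimalEquivalent G σ σ' =
  Equivalent G σ σ' × (∀ τ → Equivalent G σ τ → numEdges σ' ≤ numEdges τ)

-- Resigning Σ at v turns the d negative edges at v positive and the p positive
-- edges at v negative and touches no other edge, so it changes |Σ| by p − d.
-- If Σ is minimal in its switching class this change is not negative, so d ≤ p;
-- and d + p is the degree of v in G, at most n − 1. Hence 2d ≤ n − 1.
module Submission where

open import Defs
open import Data.Nat using (ℕ; _≤_; _∸_; _/_)
open import Data.Fin using (Fin)

open import Data.Nat using (zero; suc; _+_; _*_; _<ᵇ_; z≤n; s≤s)
open import Data.Nat.Properties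
  using (+-0-commutativeMonoid; +-identityʳ; *-comm; <-asym; ≤-antisym; ≮⇒≥; <ᵇ-reflects-<;
         +-mono-≤; +-monoˡ-≤; +-monoʳ-≤; +-cancelˡ-≤; ≤-trans; ≤-reflexive; module ≤-Reasoning)
open import Data.Nat.DivMod using (m*n/n≡m; /-monoˡ-≤)
open import Data.Nat.ListAction using () renaming (sum to listSum)
open import Data.Bool using (Bool; true; false; _∧_; _xor_; not; if_then_else_)
open import Data.Bool.Properties using (∧-comm; ∧-zeroʳ; ∧-identityʳ; ∧-conicalʳ; xor-comm; xor-same)
open import Data.Fin as Fin using (toℕ; _≟_; punchIn)
open import Data.Fin.Properties using (toℕ-injective; punchInᵢ≢i)
open import Data.List using (map; tabulate; allFin)
open import Data.List.Properties using (map-cong; map-tabulate)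
open import Data.Product using (_,_; proj₁)
open import Function using (_∘_; id)
open import Relation.Nullary using (contradiction; yes; no)
open import Relation.Nullary.Decidable using (⌊_⌋; isYes≗does; dec-true; dec-false)
open import Relation.Nullary.Reflects using (ofʸ; ofⁿ)
open import Relation.Binary.PropositionalEquality
  using (_≡_; _≢_; refl; sym; trans; cong; cong₂; module ≡-Reasoning)
open import Relation.Binary.Construct.Closure.ReflexiveTransitive using (ε; _◅_; _◅◅_)
open import Algebra.Properties.CommutativeMonoid.Sum +-0-commutativeMonoid
  using (sum; sum-syntax; sum-cong-≗; ∑-distrib-+; ∑-comm; sum-remove; sum-replicate-zero)

𝟙 : Bool → ℕ
𝟙 b = if b then 1 else 0

_≺_ : ∀ {n} → Fin n → Fin n → Bool
i ≺ j = toℕ i <ᵇ toℕ j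

IsSymmetric : ∀ {n} → Sig n → Set
IsSymmetric σ = ∀ i j → σ i j ≡ σ j i

cut : ∀ {n} → Fin n → Sig n
cut v i j = ⌊ i ≟ v ⌋ xor ⌊ j ≟ v ⌋

-- resign G v σ i j is definitionally σ i j xor star G v i j.
star : ∀ {n} → SimpleGraph n → Fin n → Sig n
star G v i j = adj G i j ∧ cut v i j

positive : ∀ {n} → SimpleGraph n → Sig n → Sig n
positive G σ i j = adj G i j ∧ not (σ i j)

𝟙≤1 : ∀ b → 𝟙 b ≤ 1
𝟙≤1 false = z≤n
𝟙≤1 true  = s≤s z≤n

listSum-tabulate : ∀ {n} (f : Fin n → ℕ) → listSum (tabulate f) ≡ sum f
listSum-tabulate {zero}  f = refl
listSum-tabulate {suc n} f = cong (f Fin.zero +_) (listSum-tabulate (f ∘ Fin.suc))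

count≡∑ : ∀ {n} (p : Fin n → Bool) → count p ≡ ∑[ i < n ] 𝟙 (p i)
count≡∑ p = trans (cong listSum (map-tabulate id (𝟙 ∘ p))) (listSum-tabulate (𝟙 ∘ p))

count-cong : ∀ {n} {p q : Fin n → Bool} → (∀ i → p i ≡ q i) → count p ≡ count q
count-cong {n} p≗q = cong listSum (map-cong (cong 𝟙 ∘ p≗q) (allFin n))

numEdges≡∑∑ : ∀ {n} (σ : Sig n) → numEdges σ ≡ ∑[ i < n ] ∑[ j < n ] 𝟙 (i ≺ j ∧ σ i j)
numEdges≡∑∑ {n} σ =
  trans (cong listSum (map-tabulate id row)) (trans (listSum-tabulate row) (sum-cong-≗ (count≡∑ ∘ σ≺)))
  where
  σ≺ : Fin n → Fin n → Bool
  σ≺ i j = i ≺ j ∧ σ i j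
  row : Fin n → ℕ
  row i = count (σ≺ i)

∑∑-distrib-+ : ∀ {m n} (f g : Fin m → Fin n → ℕ) →
  ∑[ i < m ] ∑[ j < n ] (f i j + g i j) ≡ ∑[ i < m ] ∑[ j < n ] f i j + ∑[ i < m ] ∑[ j < n ] g i j
∑∑-distrib-+ f g = trans (sum-cong-≗ (λ i → ∑-distrib-+ (f i) (g i))) (∑-distrib-+ (λ i → sum (f i)) (λ i → sum (g i)))

⌊≟⌋-refl : ∀ {n} (v : Fin n) → ⌊ v ≟ v ⌋ ≡ true
⌊≟⌋-refl v = trans (isYes≗does (v ≟ v)) (dec-true (v ≟ v) refl)

⌊≟⌋-≢ : ∀ {n} {i v : Fin n} → i ≢ v → ⌊ i ≟ v ⌋ ≡ false
⌊≟⌋-≢ {i = i} {v} i≢v = trans (isYes≗does (i ≟ v)) (dec-false (i ≟ v) i≢v)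

∑-pick : ∀ {n} (p : Fin n → Bool) (v : Fin n) → ∑[ i < n ] 𝟙 (⌊ i ≟ v ⌋ ∧ p i) ≡ 𝟙 (p v)
∑-pick {suc n} p v = begin
  sum t                       ≡⟨ sum-remove {i = v} t ⟩
  t v + sum (t ∘ punchIn v)   ≡⟨ cong₂ _+_ (cong (λ b → 𝟙 (b ∧ p v)) (⌊≟⌋-refl v)) t∘punchIn≡0 ⟩
  𝟙 (p v) + 0                 ≡⟨ +-identityʳ _ ⟩
  𝟙 (p v)                     ∎
  where
  open ≡-Reasoning
  t : Fin (suc n) → ℕ
  t i = 𝟙 (⌊ i ≟ v ⌋ ∧ p i)
  t∘punchIn≡0 : sum (t ∘ punchIn v) ≡ 0
  t∘punchIn≡0 = trans (sum-cong-≗ (λ j → cong (λ b → 𝟙 (b ∧ p (punchIn v j))) (⌊≟⌋-≢ (punchInᵢ≢i v j))))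
                      (sum-replicate-zero n)

∑𝟙≤ : ∀ {n} (p : Fin n → Bool) → ∑[ i < n ] 𝟙 (p i) ≤ n
∑𝟙≤ {zero}  p = z≤n
∑𝟙≤ {suc n} p = +-mono-≤ (𝟙≤1 (p Fin.zero)) (∑𝟙≤ (p ∘ Fin.suc))

count≤n∸1 : ∀ {n} (p : Fin n → Bool) (v : Fin n) → p v ≡ false → count p ≤ n ∸ 1
count≤n∸1 {suc n} p v pv = begin
  count p                               ≡⟨ count≡∑ p ⟩
  sum (𝟙 ∘ p)                           ≡⟨ sum-remove {i = v} (𝟙 ∘ p) ⟩
  𝟙 (p v) + sum (𝟙 ∘ p ∘ punchIn v)    ≡⟨ cong (λ b → 𝟙 b + sum (𝟙 ∘ p ∘ punchIn v)) pv ⟩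
  sum (𝟙 ∘ p ∘ punchIn v)               ≤⟨ ∑𝟙≤ (p ∘ punchIn v) ⟩
  n                                     ∎
  where open ≤-Reasoning

𝟙-split : ∀ b p q → (b ≡ true → p xor q ≡ true) → 𝟙 b ≡ 𝟙 (p ∧ b) + 𝟙 (q ∧ b)
𝟙-split false p     q     _ rewrite ∧-zeroʳ p | ∧-zeroʳ q = refl
𝟙-split true  false false h = contradiction (h refl) λ ()
𝟙-split true  false true  _ = refl
𝟙-split true  true  false _ = refl
𝟙-split true  true  true  h = contradiction (h refl) λ ()

≺-xor : ∀ {n} {i j : Fin n} → i ≢ j → (i ≺ j) xor (j ≺ i) ≡ true
≺-xor {i = i} {j} i≢j
  with toℕ i <ᵇ toℕ j | <ᵇ-reflects-< (toℕ i) (toℕ j) | toℕ j <ᵇ toℕ i | <ᵇ-reflects-< (toℕ j) (toℕ i)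
... | true  | ofʸ i<j | true  | ofʸ j<i = contradiction j<i (<-asym i<j)
... | true  | _       | false | _       = refl
... | false | _       | true  | _       = refl
... | false | ofⁿ i≮j | false | ofⁿ j≮i =
  contradiction (toℕ-injective (≤-antisym (≮⇒≥ j≮i) (≮⇒≥ i≮j))) i≢j

cut-diag : ∀ {n} (v i : Fin n) → cut v i i ≡ false
cut-diag v i = xor-same ⌊ i ≟ v ⌋

-- Every edge of h has exactly one endpoint equal to v; split the count by which one.
numEdges-star : ∀ {n} (h : Sig n) (v : Fin n) → IsSymmetric h →
  (∀ i j → h i j ≡ true → cut v i j ≡ true) → numEdges h ≡ degSig h v
numEdges-star {n} h v h-sym h⊆cut = begin
  numEdges h
    ≡⟨ numEdges≡∑∑ h ⟩
  ∑[ i < n ] ∑[ j < n ] 𝟙 (i ≺ j ∧ h i j)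
    ≡⟨ sum-cong-≗ (λ i → sum-cong-≗ (λ j →
         𝟙-split (i ≺ j ∧ h i j) ⌊ i ≟ v ⌋ ⌊ j ≟ v ⌋ (h⊆cut i j ∘ ∧-conicalʳ (i ≺ j) (h i j)))) ⟩
  ∑[ i < n ] ∑[ j < n ] (atRow i j + atCol i j)
    ≡⟨ ∑∑-distrib-+ atRow atCol ⟩
  ∑[ i < n ] ∑[ j < n ] atRow i j + ∑[ i < n ] ∑[ j < n ] atCol i j
    ≡⟨ cong (_+ ∑[ i < n ] ∑[ j < n ] atCol i j) (∑-comm atRow) ⟩
  ∑[ j < n ] ∑[ i < n ] atRow i j + ∑[ i < n ] ∑[ j < n ] atCol i j
    ≡⟨ cong₂ _+_ (sum-cong-≗ (λ j → ∑-pick (λ i → i ≺ j ∧ h i j) v))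
                 (sum-cong-≗ (λ i → ∑-pick (λ j → i ≺ j ∧ h i j) v)) ⟩
  ∑[ j < n ] 𝟙 (v ≺ j ∧ h v j) + ∑[ j < n ] 𝟙 (j ≺ v ∧ h j v)
    ≡⟨ ∑-distrib-+ (λ j → 𝟙 (v ≺ j ∧ h v j)) (λ j → 𝟙 (j ≺ v ∧ h j v)) ⟨
  ∑[ j < n ] (𝟙 (v ≺ j ∧ h v j) + 𝟙 (j ≺ v ∧ h j v))
    ≡⟨ sum-cong-≗ (λ j → trans (cong (λ b → 𝟙 (v ≺ j ∧ h v j) + 𝟙 (j ≺ v ∧ b)) (h-sym j v))
                                (sym (𝟙-split (h v j) (v ≺ j) (j ≺ v) (≺-xor ∘ v≢ j)))) ⟩
  ∑[ j < n ] 𝟙 (h v j)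
    ≡⟨ count≡∑ (h v) ⟨
  degSig h v ∎
  where
  open ≡-Reasoning
  atRow atCol : Fin n → Fin n → ℕ
  atRow i j = 𝟙 (⌊ i ≟ v ⌋ ∧ (i ≺ j ∧ h i j))
  atCol i j = 𝟙 (⌊ j ≟ v ⌋ ∧ (i ≺ j ∧ h i j))
  v≢ : ∀ j → h v j ≡ true → v ≢ j
  v≢ j hvj refl = contradiction (trans (sym (h⊆cut v v hvj)) (cut-diag v v)) λ ()

𝟙-xor-exchange : ∀ l s r → 𝟙 (l ∧ (s xor r)) + 𝟙 (l ∧ (s ∧ r)) ≡ 𝟙 (l ∧ s) + 𝟙 (l ∧ (not s ∧ r))
𝟙-xor-exchange false _     _     = refl
𝟙-xor-exchange true  false false = refl
𝟙-xor-exchange true  false true  = refl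
𝟙-xor-exchange true  true  false = refl
𝟙-xor-exchange true  true  true  = refl

numEdges-xor : ∀ {n} (σ ρ : Sig n) →
  numEdges (λ i j → σ i j xor ρ i j) + numEdges (λ i j → σ i j ∧ ρ i j)
    ≡ numEdges σ + numEdges (λ i j → not (σ i j) ∧ ρ i j)
numEdges-xor {n} σ ρ = begin
  numEdges σ⊕ρ + numEdges σ∩ρ
    ≡⟨ cong₂ _+_ (numEdges≡∑∑ σ⊕ρ) (numEdges≡∑∑ σ∩ρ) ⟩
  ∑[ i < n ] ∑[ j < n ] 𝟙 (i ≺ j ∧ σ⊕ρ i j) + ∑[ i < n ] ∑[ j < n ] 𝟙 (i ≺ j ∧ σ∩ρ i j)
    ≡⟨ ∑∑-distrib-+ (λ i j → 𝟙 (i ≺ j ∧ σ⊕ρ i j)) (λ i j → 𝟙 (i ≺ j ∧ σ∩ρ i j)) ⟨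
  ∑[ i < n ] ∑[ j < n ] (𝟙 (i ≺ j ∧ σ⊕ρ i j) + 𝟙 (i ≺ j ∧ σ∩ρ i j))
    ≡⟨ sum-cong-≗ (λ i → sum-cong-≗ (λ j → 𝟙-xor-exchange (i ≺ j) (σ i j) (ρ i j))) ⟩
  ∑[ i < n ] ∑[ j < n ] (𝟙 (i ≺ j ∧ σ i j) + 𝟙 (i ≺ j ∧ ρ∖σ i j))
    ≡⟨ ∑∑-distrib-+ (λ i j → 𝟙 (i ≺ j ∧ σ i j)) (λ i j → 𝟙 (i ≺ j ∧ ρ∖σ i j)) ⟩
  ∑[ i < n ] ∑[ j < n ] 𝟙 (i ≺ j ∧ σ i j) + ∑[ i < n ] ∑[ j < n ] 𝟙 (i ≺ j ∧ ρ∖σ i j)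
    ≡⟨ cong₂ _+_ (numEdges≡∑∑ σ) (numEdges≡∑∑ ρ∖σ) ⟨
  numEdges σ + numEdges ρ∖σ ∎
  where
  open ≡-Reasoning
  σ⊕ρ σ∩ρ ρ∖σ : Sig n
  σ⊕ρ i j = σ i j xor ρ i j
  σ∩ρ i j = σ i j ∧ ρ i j
  ρ∖σ i j = not (σ i j) ∧ ρ i j

star-sym : ∀ {n} (G : SimpleGraph n) (v : Fin n) → IsSymmetric (star G v)
star-sym G v i j = cong₂ _∧_ (adj-sym G i j) (xor-comm ⌊ i ≟ v ⌋ ⌊ j ≟ v ⌋)

star-row : ∀ {n} (G : SimpleGraph n) (v j : Fin n) → star G v v j ≡ adj G v j
star-row G v j rewrite ⌊≟⌋-refl v with j ≟ v
... | yes refl rewrite irrefl G j = refl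
... | no _     = ∧-identityʳ (adj G v j)

∧-implied : ∀ s a → (s ≡ true → a ≡ true) → s ∧ a ≡ s
∧-implied false a _ = refl
∧-implied true  a h = h refl

xor-∧-implied : ∀ s a c → (s ≡ true → a ≡ true) → s xor (a ∧ c) ≡ true → a ≡ true
xor-∧-implied s     true  c _ _ = refl
xor-∧-implied true  false c h _ = h refl
xor-∧-implied false false c _ e = e

IsSignature-resign : ∀ {n} {G : SimpleGraph n} {σ : Sig n} (v : Fin n) →
  IsSignature G σ → IsSignature G (resign G v σ)
IsSignature-resign {G = G} {σ} v σ-sig = record
  { sig-sym = λ i j → cong₂ _xor_ (sig-sym i j) (star-sym G v i j)
  ; sig-sub = λ i j → xor-∧-implied (σ i j) (adj G i j) (cut v i j) (sig-sub i j)
  }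
  where open IsSignature σ-sig

IsSignature-resp : ∀ {n} {G : SimpleGraph n} {σ τ : Sig n} →
  (∀ i j → σ i j ≡ τ i j) → IsSignature G σ → IsSignature G τ
IsSignature-resp σ≗τ σ-sig = record
  { sig-sym = λ i j → trans (sym (σ≗τ i j)) (trans (sig-sym i j) (σ≗τ j i))
  ; sig-sub = λ i j τij → sig-sub i j (trans (σ≗τ i j) τij)
  }
  where open IsSignature σ-sig

IsSignature-Equivalent : ∀ {n} {G : SimpleGraph n} {σ τ : Sig n} →
  Equivalent G σ τ → IsSignature G σ → IsSignature G τ
IsSignature-Equivalent ε                  σ-sig = σ-sig
IsSignature-Equivalent ((v , τ≗) ◅ steps) σ-sig =
  IsSignature-Equivalent steps (IsSignature-resp (λ i j → sym (τ≗ i j)) (IsSignature-resign v σ-sig))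

numEdges-resign : ∀ {n} (G : SimpleGraph n) {σ : Sig n} (v : Fin n) → IsSignature G σ →
  numEdges (resign G v σ) + degSig σ v ≡ numEdges σ + degSig (positive G σ) v
numEdges-resign {n} G {σ} v σ-sig = begin
  numEdges (resign G v σ) + degSig σ v
    ≡⟨ cong (numEdges (resign G v σ) +_) negative-at-v ⟨
  numEdges (resign G v σ) + numEdges σ∩star
    ≡⟨ numEdges-xor σ (star G v) ⟩
  numEdges σ + numEdges star∖σ
    ≡⟨ cong (numEdges σ +_) positive-at-v ⟩
  numEdges σ + degSig (positive G σ) v ∎
  where
  open ≡-Reasoning
  open IsSignature σ-sig
  σ∩star star∖σ : Sig n
  σ∩star i j = σ i j ∧ star G v i j
  star∖σ i j = not (σ i j) ∧ star G v i j
  ∧star⊆cut : ∀ (f : Sig n) i j → f i j ∧ star G v i j ≡ true → cut v i j ≡ true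
  ∧star⊆cut f i j = ∧-conicalʳ (adj G i j) (cut v i j) ∘ ∧-conicalʳ (f i j) (star G v i j)
  negative-at-v : numEdges σ∩star ≡ degSig σ v
  negative-at-v =
    trans (numEdges-star σ∩star v (λ i j → cong₂ _∧_ (sig-sym i j) (star-sym G v i j)) (∧star⊆cut σ))
          (count-cong (λ j → trans (cong (σ v j ∧_) (star-row G v j))
                                    (∧-implied (σ v j) (adj G v j) (sig-sub v j))))
  positive-at-v : numEdges star∖σ ≡ degSig (positive G σ) v
  positive-at-v =
    trans (numEdges-star star∖σ v (λ i j → cong₂ _∧_ (cong not (sig-sym i j)) (star-sym G v i j))
                         (∧star⊆cut (λ i j → not (σ i j))))
          (count-cong (λ j → trans (cong (not (σ v j) ∧_) (star-row G v j))
                                    (∧-comm (not (σ v j)) (adj G v j))))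

𝟙-split-implied : ∀ s a → (s ≡ true → a ≡ true) → 𝟙 s + 𝟙 (a ∧ not s) ≡ 𝟙 a
𝟙-split-implied false a     _ rewrite ∧-identityʳ a = refl
𝟙-split-implied true  false h = contradiction (h refl) λ ()
𝟙-split-implied true  true  _ = refl

degSig+degSig-positive : ∀ {n} {G : SimpleGraph n} {σ : Sig n} (v : Fin n) → IsSignature G σ →
  degSig σ v + degSig (positive G σ) v ≡ degSig (adj G) v
degSig+degSig-positive {n} {G} {σ} v σ-sig = begin
  degSig σ v + degSig (positive G σ) v
    ≡⟨ cong₂ _+_ (count≡∑ (σ v)) (count≡∑ (positive G σ v)) ⟩
  ∑[ j < n ] 𝟙 (σ v j) + ∑[ j < n ] 𝟙 (positive G σ v j)
    ≡⟨ ∑-distrib-+ (𝟙 ∘ σ v) (𝟙 ∘ positive G σ v) ⟨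
  ∑[ j < n ] (𝟙 (σ v j) + 𝟙 (positive G σ v j))
    ≡⟨ sum-cong-≗ (λ j → 𝟙-split-implied (σ v j) (adj G v j) (IsSignature.sig-sub σ-sig v j)) ⟩
  ∑[ j < n ] 𝟙 (adj G v j)
    ≡⟨ count≡∑ (adj G v) ⟨
  degSig (adj G) v ∎
  where open ≡-Reasoning

minimal⇒degSig≤positive : ∀ {n} {G : SimpleGraph n} {σ σ' : Sig n} (v : Fin n) →
  IsSignature G σ' → IsMinimalEquivalent G σ σ' → degSig σ' v ≤ degSig (positive G σ') v
minimal⇒degSig≤positive {G = G} {σ} {σ'} v σ'-sig (σ≈σ' , σ'-min) =
  +-cancelˡ-≤ (numEdges σ') (degSig σ' v) (degSig (positive G σ') v) (begin
    numEdges σ' + degSig σ' v               ≤⟨ +-monoˡ-≤ (degSig σ' v) (σ'-min (resign G v σ') σ≈resign) ⟩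
    numEdges (resign G v σ') + degSig σ' v  ≡⟨ numEdges-resign G v σ'-sig ⟩
    numEdges σ' + degSig (positive G σ') v  ∎)
  where
  open ≤-Reasoning
  σ≈resign : Equivalent G σ (resign G v σ')
  σ≈resign = σ≈σ' ◅◅ (v , λ _ _ → refl) ◅ ε

m+m≤n⇒m≤n/2 : ∀ {m n} → m + m ≤ n → m ≤ n / 2
m+m≤n⇒m≤n/2 {m} {n} m+m≤n = begin
  m          ≡⟨ m*n/n≡m m 2 ⟨
  m * 2 / 2  ≤⟨ /-monoˡ-≤ 2 (≤-trans (≤-reflexive m*2≡m+m) m+m≤n) ⟩
  n / 2      ∎
  where
  open ≤-Reasoning
  m*2≡m+m : m * 2 ≡ m + m
  m*2≡m+m = trans (*-comm m 2) (cong (m +_) (+-identityʳ m))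

theorem2 : (n : ℕ) (G : SimpleGraph n) (σ σ' : Sig n) →
    IsSignature G σ → IsMinimalEquivalent G σ σ' →
    (v : Fin n) → degSig σ' v ≤ (n ∸ 1) / 2
theorem2 n G σ σ' σ-sig σ'-min v = m+m≤n⇒m≤n/2 (begin
  degSig σ' v + degSig σ' v               ≤⟨ +-monoʳ-≤ (degSig σ' v) (minimal⇒degSig≤positive v σ'-sig σ'-min) ⟩
  degSig σ' v + degSig (positive G σ') v  ≡⟨ degSig+degSig-positive v σ'-sig ⟩
  degSig (adj G) v                        ≤⟨ count≤n∸1 (adj G v) v (irrefl G v) ⟩
  n ∸ 1                                   ∎)
  where
  open ≤-Reasoning
  σ'-sig : IsSignature G σ'
  σ'-sig = IsSignature-Equivalent (proj₁ σ'-min) σ-sig
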